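{- Let $n=n_1+\cdots+n_m$ with positive integers $n_i$, and for each $i$ let $D_i$ be a subgroup of $GL_{n_i}(\mathbb{F}_{q^{r_i}})$. Identify $D:=\prod_{i=1}^mD_i$ with a subgroup of the block-diagonal Levi subgroup of the parabolic $P_{(n_1,\dots,n_m)}$ of $GL_n(\overline{\mathbb{F}}_q)$. Then there exists a constant $C_2(n)$ depending only on $n$ such that $M_D\le C_2(n)\prod_{i=1}^mM_{D_i}$.
   Context: For a finite subgroup $D$ of $GL_k(\overline{\mathbb{F}}_q)$ and $g\in D$, $M_D(g)$ is the number of elements of $D$ having the same characteristic polynomial as $g$, and $M_D=\max_{g\in D}M_D(g)$. -}

module Defs where

open import Level using (0ℓ)
open import Algebra.Bundles using (CommutativeRing)
open import Data.Nat as ℕ using (ℕ; zero; suc; _^_; _≤_; _⊔_; _<_)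
open import Data.Nat.Primality using (Prime)
open import Data.Fin as Fin using (Fin; zero; suc; punchIn; splitAt; toℕ)
open import Data.Sum using (inj₁; inj₂)
open import Data.Bool using (if_then_else_)
open import Data.List as List using (List; []; _∷_; [_]; length; filter; map; foldr; concatMap; allFin; upTo; _++_)
open import Data.List.Relation.Unary.All using (All)
open import Data.List.Relation.Unary.Any using (Any)
open import Data.List.Relation.Unary.AllPairs using (AllPairs)
open import Data.List.Relation.Unary.All.Properties using ()
import Data.List.Relation.Unary.All as All
open import Data.Product using (Σ; ∃; _×_; _,_)
open import Relation.Nullary using (¬_; Dec; yes; no; does)
open import Relation.Binary using (Decidable)

record DecField : Set₁ where
  field
    commRing : CommutativeRing 0ℓ 0ℓ
  open CommutativeRing commRing public hiding (ring)
  field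
    _≟_     : Decidable _≈_
    1≉0     : ¬ (1# ≈ 0#)
    inverse : ∀ x → ¬ (x ≈ 0#) → ∃ λ y → (x * y) ≈ 1#

module _ (K : DecField) where
  open DecField K using (Carrier; _≈_; _+_; _*_; -_; 0#; 1#; _≟_)

  pow : Carrier → ℕ → Carrier
  pow x zero    = 1#
  pow x (suc k) = x * pow x k

  natK : ℕ → Carrier
  natK zero    = 0#
  natK (suc k) = 1# + natK k

  HasChar : ℕ → Set
  HasChar p = Prime p × (natK p ≈ 0#)

  -- Polynomials over K as coefficient lists (constant term first);
  -- trailing zeros allowed.

  Poly : Set
  Poly = List Carrier

  _+ₚ_ : Poly → Poly → Poly
  []      +ₚ q       = q
  (a ∷ p) +ₚ []      = a ∷ p
  (a ∷ p) +ₚ (b ∷ q) = (a + b) ∷ (p +ₚ q)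

  negₚ : Poly → Poly
  negₚ = map (-_)

  _*ₚ_ : Poly → Poly → Poly
  []      *ₚ q = []
  (a ∷ p) *ₚ q = map (a *_) q +ₚ (0# ∷ (p *ₚ q))

  coeff : Poly → ℕ → Carrier
  coeff []      k       = 0#
  coeff (a ∷ p) zero    = a
  coeff (a ∷ p) (suc k) = coeff p k

  evalₚ : Poly → Carrier → Carrier
  evalₚ []      x = 0#
  evalₚ (a ∷ p) x = a + x * evalₚ p x

  _≈ₚ_ : Poly → Poly → Set
  p ≈ₚ q = All (λ k → coeff p k ≈ coeff q k) (upTo (length p ⊔ length q))

  _≟ₚ_ : (p q : Poly) → Dec (p ≈ₚ q)
  p ≟ₚ q = All.all? (λ k → coeff p k ≟ coeff q k) (upTo (length p ⊔ length q))

  -- algebraically closed: every monic polynomial of degree ≥ 1 has a root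
  AlgClosed : Set
  AlgClosed = ∀ (a : Carrier) (cs : List Carrier) →
              ∃ λ x → evalₚ (a ∷ cs ++ [ 1# ]) x ≈ 0#

  Mat : ℕ → Set
  Mat n = Fin n → Fin n → Carrier

  _≋_ : ∀ {n} → Mat n → Mat n → Set
  A ≋ B = ∀ i j → A i j ≈ B i j

  sumFin : ∀ {A : Set} (n : ℕ) → (Fin n → A) → (A → A → A) → A → A
  sumFin n f _⊕_ e = foldr (λ j acc → f j ⊕ acc) e (allFin n)

  matMul : ∀ {n} → Mat n → Mat n → Mat n
  matMul {n} A B i k = sumFin n (λ j → A i j * B j k) _+_ 0#

  idMat : ∀ {n} → Mat n
  idMat i j = if does (i Fin.≟ j) then 1# else 0#

  altSign : ℕ → Poly → Poly
  altSign zero    p = p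
  altSign (suc k) p = negₚ (altSign k p)

  detₚ : (n : ℕ) → (Fin n → Fin n → Poly) → Poly
  detₚ zero    A = [ 1# ]
  detₚ (suc n) A = sumFin (suc n)
    (λ j → altSign (toℕ j) (A zero j *ₚ detₚ n (λ i k → A (suc i) (punchIn j k))))
    _+ₚ_ []

  charPoly : ∀ {n} → Mat n → Poly
  charPoly {n} A = detₚ n (λ i j →
    (if does (i Fin.≟ j) then (0# ∷ 1# ∷ []) else []) +ₚ [ - A i j ])

  record FinSubgroup (k : ℕ) : Set where
    field
      elems    : List (Mat k)
      distinct : AllPairs (λ A B → ¬ (A ≋ B)) elems
      hasId    : Any (λ B → idMat ≋ B) elems
      closed   : All (λ A → All (λ B → Any (λ C → matMul A B ≋ C) elems) elems) elems
      inverses : All (λ A → Any (λ B → matMul A B ≋ idMat) elems) elems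

  -- entries lie in F_{q^r} ⊆ K, i.e. satisfy x^(q^r) = x
  InField : ℕ → ℕ → Carrier → Set
  InField q r x = pow x (q ^ r) ≈ x

  OverField : ∀ {k} → ℕ → ℕ → FinSubgroup k → Set
  OverField q r D = All (λ A → ∀ i j → InField q r (A i j)) (FinSubgroup.elems D)

  MD-of : ∀ {k} → List (Mat k) → Mat k → ℕ
  MD-of D g = length (filter (λ h → charPoly h ≟ₚ charPoly g) D)

  MD : ∀ {k} → List (Mat k) → ℕ
  MD D = foldr _⊔_ 0 (map (MD-of D) D)

  total : (m : ℕ) → (Fin m → ℕ) → ℕ
  total zero    ns = 0
  total (suc m) ns = ns zero ℕ.+ total m (λ i → ns (suc i))

  blockDiag₂ : ∀ {a b} → Mat a → Mat b → Mat (a ℕ.+ b)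
  blockDiag₂ {a} A B i j with splitAt a i | splitAt a j
  ... | inj₁ i' | inj₁ j' = A i' j'
  ... | inj₂ i' | inj₂ j' = B i' j'
  ... | _       | _       = 0#

  blockDiag : (m : ℕ) (ns : Fin m → ℕ) → ((i : Fin m) → Mat (ns i)) → Mat (total m ns)
  blockDiag zero    ns g = λ ()
  blockDiag (suc m) ns g = blockDiag₂ (g zero) (blockDiag m (λ i → ns (suc i)) (λ i → g (suc i)))

  tuples : (m : ℕ) (ns : Fin m → ℕ) → ((i : Fin m) → List (Mat (ns i))) →
           List ((i : Fin m) → Mat (ns i))
  tuples zero    ns Ls = [ (λ ()) ]
  tuples (suc m) ns Ls =
    concatMap (λ g₀ → map (λ rest → λ { zero → g₀ ; (suc i) → rest i })
                          (tuples m (λ i → ns (suc i)) (λ i → Ls (suc i))))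
              (Ls zero)

  productGroup : (m : ℕ) (ns : Fin m → ℕ) → ((i : Fin m) → FinSubgroup (ns i)) →
                 List (Mat (total m ns))
  productGroup m ns Ds =
    map (blockDiag m ns) (tuples m ns (λ i → FinSubgroup.elems (Ds i)))

  prodFin : (m : ℕ) → (Fin m → ℕ) → ℕ
  prodFin zero    f = 1
  prodFin (suc m) f = f zero ℕ.* prodFin m (λ i → f (suc i))

-- If diag(g₁, …, gₘ) has characteristic polynomial f, then f = χ(g₁) ⋯ χ(gₘ), so every χ(gᵢ) is
-- a monic divisor of f. Over an algebraically closed field f splits into n = deg f linear factors,
-- and peeling them off one root at a time shows that f has at most 2ⁿ monic divisors. Hence the
-- tuples with χ(diag(gᵢ)) = f number at most ∏ᵢ 2ⁿ M_{Dᵢ} ≤ (2ⁿ)ⁿ ∏ᵢ M_{Dᵢ}, as m ≤ n.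
module Submission where

open import Level using (0ℓ)
open import Defs
  using (DecField; FinSubgroup; AlgClosed; HasChar; OverField; Mat; MD; MD-of;
         total; prodFin; tuples; blockDiag; blockDiag₂; productGroup)
import Defs
open import Algebra.Bundles using (CommutativeRing; CommutativeSemigroup)
import Algebra.Properties.CommutativeSemigroup as CommSemigroupProperties
import Algebra.Solver.Ring.NaturalCoefficients.Default as SemiringSolver
open import Data.Bool using (Bool; true; false; if_then_else_)
open import Data.Empty using (⊥-elim)
open import Data.Fin as Fin using (Fin; zero; suc; toℕ; punchIn; splitAt; join; _↑ˡ_; _↑ʳ_)
open import Data.Fin.Properties using (suc-injective; splitAt-↑ˡ; splitAt-↑ʳ; toℕ-↑ˡ; join-splitAt; ↑ˡ-injective; ↑ʳ-injective)
open import Data.List using (List; []; _∷_; [_]; _++_; map; foldr; tabulate; length; filter; drop; concatMap)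
open import Data.Nat as ℕ using (ℕ; zero; suc; _≤_; _<_; _≥_; z≤n; s≤s; _^_; _⊔_)
import Data.Nat.Properties as ℕₚ
open import Data.Nat.Solver using (module +-*-Solver)
open import Data.List.Membership.Propositional.Properties using (∈-upTo⁺)
open import Data.List.Properties using (length-++; length-map; length-filter; filter-++; filter-none; foldr-preservesᵇ; foldr-preservesᵒ)
import Data.List.Relation.Unary.All as All
import Data.List.Relation.Unary.All.Properties as AllP
import Data.List.Relation.Binary.Sublist.Propositional as Sublist
import Data.List.Relation.Binary.Sublist.Propositional.Properties as Sublistₚ
open import Data.List.Relation.Unary.Any as Any using (Any; here; there)
open import Data.List.Relation.Unary.Any.Properties using (++⁺ˡ; ++⁺ʳ; map⁺)
open import Data.Product using (∃; _×_; _,_; proj₁; proj₂)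
open import Data.Sum as Sum using (_⊎_; inj₁; inj₂)
open import Function using (_∘_; id; mk⇔)
open import Relation.Binary.Bundles using (Setoid)
open import Relation.Binary.PropositionalEquality as ≡ using (_≡_; _≢_)
import Relation.Binary.Reasoning.Setoid as SetoidReasoning
open import Relation.Nullary using (¬_; Dec; yes; no; does)
open import Relation.Unary as U using (Pred)
open import Relation.Nullary.Decidable using (dec-true; dec-false; does-⇔; map′)

↑ˡ≢↑ʳ : ∀ {a b} (x : Fin a) (y : Fin b) → x ↑ˡ b ≢ a ↑ʳ y
↑ˡ≢↑ʳ {a} {b} x y e with ≡.trans (≡.sym (splitAt-↑ˡ a x b)) (≡.trans (≡.cong (splitAt a) e) (splitAt-↑ʳ a b y))
... | ()

length-filter-mono : ∀ {A : Set} {P Q : Pred A 0ℓ} (P? : U.Decidable P) (Q? : U.Decidable Q) →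
                     (∀ {x} → P x → Q x) → ∀ xs → length (filter P? xs) ≤ length (filter Q? xs)
length-filter-mono P? Q? P⇒Q xs = Sublistₚ.length-mono-≤ (Sublistₚ.filter⁺ P? Q? (λ { ≡.refl → P⇒Q }) (Sublist.⊆-refl {x = xs}))

length-filter-map : ∀ {A B : Set} {P : Pred B 0ℓ} (P? : U.Decidable P) (f : A → B) xs →
                    length (filter P? (map f xs)) ≡ length (filter (P? ∘ f) xs)
length-filter-map P? f []       = ≡.refl
length-filter-map P? f (x ∷ xs) with does (P? (f x))
... | true  = ≡.cong suc (length-filter-map P? f xs)
... | false = length-filter-map P? f xs

length-filter-++ : ∀ {A : Set} {P : Pred A 0ℓ} (P? : U.Decidable P) xs ys →
                   length (filter P? (xs ++ ys)) ≡ length (filter P? xs) ℕ.+ length (filter P? ys)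
length-filter-++ P? xs ys = ≡.trans (≡.cong length (filter-++ P? xs ys)) (length-++ (filter P? xs))

length-filter-⊎ : ∀ {A : Set} {P Q R : Pred A 0ℓ} (P? : U.Decidable P) (Q? : U.Decidable Q) (R? : U.Decidable R) →
                  (∀ {x} → R x → P x ⊎ Q x) → ∀ xs →
                  length (filter R? xs) ≤ length (filter P? xs) ℕ.+ length (filter Q? xs)
length-filter-⊎ P? Q? R? R⇒P⊎Q [] = z≤n
length-filter-⊎ P? Q? R? R⇒P⊎Q (x ∷ xs) with ih ← length-filter-⊎ P? Q? R? R⇒P⊎Q xs | R? x | P? x | Q? x
... | yes _ | yes _ | yes _ = s≤s (ℕₚ.≤-trans ih (ℕₚ.+-monoʳ-≤ (length (filter P? xs)) (ℕₚ.n≤1+n _)))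
... | yes _ | yes _ | no  _ = s≤s ih
... | yes _ | no  _ | yes _ = ℕₚ.≤-trans (s≤s ih) (ℕₚ.≤-reflexive (≡.sym (ℕₚ.+-suc _ _)))
... | yes r | no ¬p | no ¬q = ⊥-elim (Sum.[ ¬p , ¬q ] (R⇒P⊎Q r))
... | no  _ | yes _ | yes _ = ℕₚ.m≤n⇒m≤1+n (ℕₚ.≤-trans ih (ℕₚ.+-monoʳ-≤ (length (filter P? xs)) (ℕₚ.n≤1+n _)))
... | no  _ | yes _ | no  _ = ℕₚ.m≤n⇒m≤1+n ih
... | no  _ | no  _ | yes _ = ℕₚ.≤-trans ih (ℕₚ.+-monoʳ-≤ (length (filter P? xs)) (ℕₚ.n≤1+n _))
... | no  _ | no  _ | no  _ = ih

length-filter-concatMap : ∀ {A B C : Set} {P : Pred A 0ℓ} {R : Pred C 0ℓ} (P? : U.Decidable P) (R? : U.Decidable R)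
                          (c : A → B → C) (ys : List B) {bound : ℕ} →
                          (∀ {x} → P x → length (filter (R? ∘ c x) ys) ≤ bound) →
                          (∀ {x y} → R (c x y) → P x) →
                          ∀ xs → length (filter R? (concatMap (λ x → map (c x) ys) xs)) ≤ length (filter P? xs) ℕ.* bound
length-filter-concatMap P? R? c ys fibre R⇒P [] = z≤n
length-filter-concatMap P? R? c ys fibre R⇒P (x ∷ xs)
  rewrite length-filter-++ R? (map (c x) ys) (concatMap (λ x → map (c x) ys) xs) | length-filter-map R? (c x) ys
  with P? x
... | yes p = ℕₚ.+-mono-≤ (fibre p) (length-filter-concatMap P? R? c ys fibre R⇒P xs)
... | no ¬p rewrite filter-none (R? ∘ c x) (All.universal (λ y → ¬p ∘ R⇒P) ys) =
  length-filter-concatMap P? R? c ys fibre R⇒P xs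

foldr-⊔-lub : ∀ {A : Set} (f : A → ℕ) {bound} → (∀ x → f x ≤ bound) → ∀ xs → foldr _⊔_ 0 (map f xs) ≤ bound
foldr-⊔-lub f {bound} f≤bound xs = foldr-preservesᵇ {P = _≤ bound} ℕₚ.⊔-lub z≤n (AllP.map⁺ (All.universal f≤bound xs))

foldr-⊔-upper : ∀ {A : Set} (f : A → ℕ) {bound} xs → Any (λ x → bound ≤ f x) xs → bound ≤ foldr _⊔_ 0 (map f xs)
foldr-⊔-upper f {bound} xs any = foldr-preservesᵒ {P = bound ≤_} upper 0 (map f xs) (inj₂ (map⁺ any))
  where
  upper : ∀ x y → bound ≤ x ⊎ bound ≤ y → bound ≤ x ⊔ y
  upper x y = Sum.[ (λ b≤x → ℕₚ.≤-trans b≤x (ℕₚ.m≤m⊔n x y)) , (λ b≤y → ℕₚ.≤-trans b≤y (ℕₚ.m≤n⊔m x y)) ]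

module Polynomials (K : DecField) where
  open DecField K hiding (zero)
  open import Algebra.Properties.Group +-group using (ε⁻¹≈ε)
  open import Algebra.Properties.AbelianGroup +-abelianGroup using (⁻¹-∙-comm)
  open import Algebra.Properties.Ring (CommutativeRing.ring commRing) using (-‿distribˡ-*)
  open SetoidReasoning setoid

  Poly : Set
  Poly = Defs.Poly K

  infixl 6 _+ₚ_
  infixl 7 _*ₚ_
  infix 4 _≐_

  _+ₚ_ : Poly → Poly → Poly
  _+ₚ_ = Defs._+ₚ_ K

  _*ₚ_ : Poly → Poly → Poly
  _*ₚ_ = Defs._*ₚ_ K

  -ₚ_ : Poly → Poly
  -ₚ_ = Defs.negₚ K

  coeff : Poly → ℕ → Carrier
  coeff = Defs.coeff K

  scale : Carrier → Poly → Poly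
  scale a = map (a *_)

  shift : Poly → Poly
  shift p = 0# ∷ p

  -- Equivalent to Defs._≈ₚ_ (see ≈ₚ⇒≐) but without reference to the lengths of the lists.
  record _≐_ (p q : Poly) : Set where
    constructor coeffwise
    field coeff-≈ : ∀ k → coeff p k ≈ coeff q k
  open _≐_ public

  ≐-refl : ∀ {p} → p ≐ p
  ≐-refl = coeffwise λ _ → refl

  ≐-sym : ∀ {p q} → p ≐ q → q ≐ p
  ≐-sym e = coeffwise λ k → sym (coeff-≈ e k)

  ≐-trans : ∀ {p q r} → p ≐ q → q ≐ r → p ≐ r
  ≐-trans e f = coeffwise λ k → trans (coeff-≈ e k) (coeff-≈ f k)

  ≐-reflexive : ∀ {p q} → p ≡ q → p ≐ q
  ≐-reflexive ≡.refl = ≐-refl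

  ≐-setoid : Setoid 0ℓ 0ℓ
  ≐-setoid = record
    { Carrier = Poly ; _≈_ = _≐_
    ; isEquivalence = record { refl = ≐-refl ; sym = ≐-sym ; trans = ≐-trans } }

  module ≐-Reasoning = SetoidReasoning ≐-setoid

  ∷-cong : ∀ {a b p q} → a ≈ b → p ≐ q → a ∷ p ≐ b ∷ q
  ∷-cong a≈b p≐q = coeffwise λ { zero → a≈b ; (suc k) → coeff-≈ p≐q k }

  ∷-injectiveʳ : ∀ {a b p q} → a ∷ p ≐ b ∷ q → p ≐ q
  ∷-injectiveʳ e = coeffwise λ k → coeff-≈ e (suc k)

  [0]≐[] : [ 0# ] ≐ []
  [0]≐[] = coeffwise λ { zero → refl ; (suc k) → refl }

  [-0]≐[] : [ - 0# ] ≐ []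
  [-0]≐[] = ≐-trans (∷-cong ε⁻¹≈ε ≐-refl) [0]≐[]

  coeff-+ₚ : ∀ p q k → coeff (p +ₚ q) k ≈ coeff p k + coeff q k
  coeff-+ₚ []      q       k       = sym (+-identityˡ _)
  coeff-+ₚ (a ∷ p) []      zero    = sym (+-identityʳ _)
  coeff-+ₚ (a ∷ p) []      (suc k) = sym (+-identityʳ _)
  coeff-+ₚ (a ∷ p) (b ∷ q) zero    = refl
  coeff-+ₚ (a ∷ p) (b ∷ q) (suc k) = coeff-+ₚ p q k

  coeff--ₚ : ∀ p k → coeff (-ₚ p) k ≈ - coeff p k
  coeff--ₚ []      k       = sym ε⁻¹≈ε
  coeff--ₚ (a ∷ p) zero    = refl
  coeff--ₚ (a ∷ p) (suc k) = coeff--ₚ p k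

  coeff-scale : ∀ a p k → coeff (scale a p) k ≈ a * coeff p k
  coeff-scale a []      k       = sym (zeroʳ a)
  coeff-scale a (b ∷ p) zero    = refl
  coeff-scale a (b ∷ p) (suc k) = coeff-scale a p k

  convolution : (ℕ → Carrier) → (ℕ → Carrier) → ℕ → Carrier
  convolution f g zero    = f 0 * g 0
  convolution f g (suc k) = f 0 * g (suc k) + convolution (f ∘ suc) g k

  convolution-cong : ∀ {f f′ g g′} → (∀ i → f i ≈ f′ i) → (∀ i → g i ≈ g′ i) →
                     ∀ k → convolution f g k ≈ convolution f′ g′ k
  convolution-cong f≈ g≈ zero    = *-cong (f≈ 0) (g≈ 0)
  convolution-cong f≈ g≈ (suc k) = +-cong (*-cong (f≈ 0) (g≈ (suc k))) (convolution-cong (f≈ ∘ suc) g≈ k)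

  convolution-zeroˡ : ∀ {f} g → (∀ i → f i ≈ 0#) → ∀ k → convolution f g k ≈ 0#
  convolution-zeroˡ g f≈0 zero    = trans (*-cong (f≈0 0) refl) (zeroˡ _)
  convolution-zeroˡ g f≈0 (suc k) =
    trans (+-cong (trans (*-cong (f≈0 0) refl) (zeroˡ _)) (convolution-zeroˡ g (f≈0 ∘ suc) k)) (+-identityˡ _)

  coeff-*ₚ : ∀ p q k → coeff (p *ₚ q) k ≈ convolution (coeff p) (coeff q) k
  coeff-*ₚ []      q k       = sym (convolution-zeroˡ (coeff q) (λ _ → refl) k)
  coeff-*ₚ (a ∷ p) q zero    = trans (coeff-+ₚ (scale a q) (shift (p *ₚ q)) 0) (trans (+-identityʳ _) (coeff-scale a q 0))
  coeff-*ₚ (a ∷ p) q (suc k) = trans (coeff-+ₚ (scale a q) (shift (p *ₚ q)) (suc k)) (+-cong (coeff-scale a q (suc k)) (coeff-*ₚ p q k))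

  +ₚ-cong : ∀ {p p′ q q′} → p ≐ p′ → q ≐ q′ → p +ₚ q ≐ p′ +ₚ q′
  +ₚ-cong {p} {p′} {q} {q′} e f = coeffwise λ k →
    trans (coeff-+ₚ p q k) (trans (+-cong (coeff-≈ e k) (coeff-≈ f k)) (sym (coeff-+ₚ p′ q′ k)))

  -ₚ-cong : ∀ {p p′} → p ≐ p′ → -ₚ p ≐ -ₚ p′
  -ₚ-cong {p} {p′} e = coeffwise λ k → trans (coeff--ₚ p k) (trans (-‿cong (coeff-≈ e k)) (sym (coeff--ₚ p′ k)))


  *ₚ-cong : ∀ {p p′ q q′} → p ≐ p′ → q ≐ q′ → p *ₚ q ≐ p′ *ₚ q′
  *ₚ-cong {p} {p′} {q} {q′} e f = coeffwise λ k →
    trans (coeff-*ₚ p q k) (trans (convolution-cong (coeff-≈ e) (coeff-≈ f) k) (sym (coeff-*ₚ p′ q′ k)))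

  +ₚ-comm : ∀ p q → p +ₚ q ≐ q +ₚ p
  +ₚ-comm p q = coeffwise λ k → trans (coeff-+ₚ p q k) (trans (+-comm _ _) (sym (coeff-+ₚ q p k)))

  +ₚ-assoc : ∀ p q r → p +ₚ q +ₚ r ≐ p +ₚ (q +ₚ r)
  +ₚ-assoc p q r = coeffwise λ k → begin
    coeff (p +ₚ q +ₚ r) k               ≈⟨ coeff-+ₚ (p +ₚ q) r k ⟩
    coeff (p +ₚ q) k + coeff r k         ≈⟨ +-cong (coeff-+ₚ p q k) refl ⟩
    coeff p k + coeff q k + coeff r k    ≈⟨ +-assoc _ _ _ ⟩
    coeff p k + (coeff q k + coeff r k)  ≈⟨ +-cong refl (coeff-+ₚ q r k) ⟨
    coeff p k + coeff (q +ₚ r) k         ≈⟨ coeff-+ₚ p (q +ₚ r) k ⟨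
    coeff (p +ₚ (q +ₚ r)) k              ∎

  +ₚ-identityʳ : ∀ p → p +ₚ [] ≡ p
  +ₚ-identityʳ []      = ≡.refl
  +ₚ-identityʳ (a ∷ p) = ≡.refl

  +ₚ-zeroʳ : ∀ p {q} → q ≐ [] → p +ₚ q ≐ p
  +ₚ-zeroʳ p {q} q≐[] = coeffwise λ k → trans (coeff-+ₚ p q k) (trans (+-cong refl (coeff-≈ q≐[] k)) (+-identityʳ _))

  +ₚ-commutativeSemigroup : CommutativeSemigroup 0ℓ 0ℓ
  +ₚ-commutativeSemigroup = record
    { Carrier = Poly ; _≈_ = _≐_ ; _∙_ = _+ₚ_
    ; isCommutativeSemigroup = record
      { isSemigroup = record
        { isMagma = record { isEquivalence = Setoid.isEquivalence ≐-setoid ; ∙-cong = +ₚ-cong }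
        ; assoc = +ₚ-assoc }
      ; comm = +ₚ-comm } }

  open CommSemigroupProperties +ₚ-commutativeSemigroup public
    using () renaming (interchange to +ₚ-interchange; x∙yz≈xz∙y to +ₚ-x∙yz≈xz∙y)

  shift-+ₚ : ∀ p q → shift (p +ₚ q) ≐ shift p +ₚ shift q
  shift-+ₚ p q = coeffwise λ { zero → sym (+-identityˡ _) ; (suc k) → refl }

  scale-distribˡ : ∀ a p q → scale a (p +ₚ q) ≐ scale a p +ₚ scale a q
  scale-distribˡ a p q = coeffwise λ k → begin
    coeff (scale a (p +ₚ q)) k                ≈⟨ coeff-scale a (p +ₚ q) k ⟩
    a * coeff (p +ₚ q) k                      ≈⟨ *-cong refl (coeff-+ₚ p q k) ⟩
    a * (coeff p k + coeff q k)               ≈⟨ distribˡ _ _ _ ⟩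
    a * coeff p k + a * coeff q k             ≈⟨ +-cong (coeff-scale a p k) (coeff-scale a q k) ⟨
    coeff (scale a p) k + coeff (scale a q) k ≈⟨ coeff-+ₚ (scale a p) (scale a q) k ⟨
    coeff (scale a p +ₚ scale a q) k          ∎

  scale-distribʳ : ∀ a b p → scale (a + b) p ≐ scale a p +ₚ scale b p
  scale-distribʳ a b p = coeffwise λ k → begin
    coeff (scale (a + b) p) k                 ≈⟨ coeff-scale (a + b) p k ⟩
    (a + b) * coeff p k                       ≈⟨ distribʳ _ _ _ ⟩
    a * coeff p k + b * coeff p k             ≈⟨ +-cong (coeff-scale a p k) (coeff-scale b p k) ⟨
    coeff (scale a p) k + coeff (scale b p) k ≈⟨ coeff-+ₚ (scale a p) (scale b p) k ⟨
    coeff (scale a p +ₚ scale b p) k          ∎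

  scale-shift : ∀ a p → scale a (shift p) ≐ shift (scale a p)
  scale-shift a p = ∷-cong (zeroʳ a) ≐-refl

  scale-assoc : ∀ a b p → scale a (scale b p) ≐ scale (a * b) p
  scale-assoc a b p = coeffwise λ k →
    trans (coeff-scale a (scale b p) k)
          (trans (*-cong refl (coeff-scale b p k)) (trans (sym (*-assoc _ _ _)) (sym (coeff-scale (a * b) p k))))

  scale-zero : ∀ p → scale 0# p ≐ []
  scale-zero p = coeffwise λ k → trans (coeff-scale 0# p k) (zeroˡ _)

  scale-one : ∀ p → scale 1# p ≐ p
  scale-one p = coeffwise λ k → trans (coeff-scale 1# p k) (*-identityˡ _)


  ∷-split : ∀ a p → a ∷ p ≐ [ a ] +ₚ shift p
  ∷-split a p = ∷-cong (sym (+-identityʳ a)) ≐-refl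

  *ₚ-zeroʳ : ∀ p → p *ₚ [] ≐ []
  *ₚ-zeroʳ []      = ≐-refl
  *ₚ-zeroʳ (a ∷ p) = coeffwise λ { zero → refl ; (suc k) → coeff-≈ (*ₚ-zeroʳ p) k }

  *ₚ-identityˡ : ∀ q → [ 1# ] *ₚ q ≐ q
  *ₚ-identityˡ q = ≐-trans (+ₚ-zeroʳ (scale 1# q) [0]≐[]) (scale-one q)

  shift-*ₚ : ∀ p q → shift p *ₚ q ≐ shift (p *ₚ q)
  shift-*ₚ p q = ≐-trans (+ₚ-comm (scale 0# q) (shift (p *ₚ q))) (+ₚ-zeroʳ (shift (p *ₚ q)) (scale-zero q))

  *ₚ-shift : ∀ p q → p *ₚ shift q ≐ shift (p *ₚ q)
  *ₚ-shift []      q = ≐-sym [0]≐[]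
  *ₚ-shift (a ∷ p) q = ≐-trans (+ₚ-cong (scale-shift a q) (∷-cong refl (*ₚ-shift p q))) (≐-sym (shift-+ₚ (scale a q) (shift (p *ₚ q))))

  *ₚ-[a] : ∀ a q → q *ₚ [ a ] ≐ scale a q
  *ₚ-[a] a []      = ≐-refl
  *ₚ-[a] a (b ∷ q) = ∷-cong (trans (+-identityʳ _) (*-comm b a)) (*ₚ-[a] a q)

  *ₚ-distribˡ : ∀ p q r → p *ₚ (q +ₚ r) ≐ p *ₚ q +ₚ p *ₚ r
  *ₚ-distribˡ []      q r = ≐-refl
  *ₚ-distribˡ (a ∷ p) q r = ≐-trans
    (+ₚ-cong (scale-distribˡ a q r) (≐-trans (∷-cong refl (*ₚ-distribˡ p q r)) (shift-+ₚ (p *ₚ q) (p *ₚ r))))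
    (+ₚ-interchange (scale a q) (scale a r) (shift (p *ₚ q)) (shift (p *ₚ r)))

  *ₚ-distribʳ : ∀ p q r → (p +ₚ q) *ₚ r ≐ p *ₚ r +ₚ q *ₚ r
  *ₚ-distribʳ []      q       r = ≐-refl
  *ₚ-distribʳ (a ∷ p) []      r = ≐-reflexive (≡.sym (+ₚ-identityʳ ((a ∷ p) *ₚ r)))
  *ₚ-distribʳ (a ∷ p) (b ∷ q) r = ≐-trans
    (+ₚ-cong (scale-distribʳ a b r) (≐-trans (∷-cong refl (*ₚ-distribʳ p q r)) (shift-+ₚ (p *ₚ r) (q *ₚ r))))
    (+ₚ-interchange (scale a r) (scale b r) (shift (p *ₚ r)) (shift (q *ₚ r)))

  scale-*ₚ : ∀ a p q → scale a p *ₚ q ≐ scale a (p *ₚ q)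
  scale-*ₚ a []      q = ≐-refl
  scale-*ₚ a (b ∷ p) q = ≐-trans
    (+ₚ-cong (≐-sym (scale-assoc a b q)) (≐-trans (∷-cong refl (scale-*ₚ a p q)) (≐-sym (scale-shift a (p *ₚ q)))))
    (≐-sym (scale-distribˡ a (scale b q) (shift (p *ₚ q))))

  *ₚ-∷ : ∀ a p q → q *ₚ (a ∷ p) ≐ scale a q +ₚ shift (q *ₚ p)
  *ₚ-∷ a p q = ≐-trans (*ₚ-cong (≐-refl {q}) (∷-split a p))
               (≐-trans (*ₚ-distribˡ q [ a ] (shift p)) (+ₚ-cong (*ₚ-[a] a q) (*ₚ-shift q p)))

  *ₚ-comm : ∀ p q → p *ₚ q ≐ q *ₚ p
  *ₚ-comm []      q = ≐-sym (*ₚ-zeroʳ q)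
  *ₚ-comm (a ∷ p) q = ≐-trans (+ₚ-cong ≐-refl (∷-cong refl (*ₚ-comm p q))) (≐-sym (*ₚ-∷ a p q))

  *ₚ-assoc : ∀ p q r → p *ₚ q *ₚ r ≐ p *ₚ (q *ₚ r)
  *ₚ-assoc []      q r = ≐-refl
  *ₚ-assoc (a ∷ p) q r = ≐-trans (*ₚ-distribʳ (scale a q) (shift (p *ₚ q)) r)
    (+ₚ-cong (scale-*ₚ a q r) (≐-trans (shift-*ₚ (p *ₚ q) r) (∷-cong refl (*ₚ-assoc p q r))))

  *ₚ-commutativeSemigroup : CommutativeSemigroup 0ℓ 0ℓ
  *ₚ-commutativeSemigroup = record
    { Carrier = Poly ; _≈_ = _≐_ ; _∙_ = _*ₚ_
    ; isCommutativeSemigroup = record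
      { isSemigroup = record
        { isMagma = record { isEquivalence = Setoid.isEquivalence ≐-setoid ; ∙-cong = *ₚ-cong }
        ; assoc = *ₚ-assoc }
      ; comm = *ₚ-comm } }

  open CommSemigroupProperties *ₚ-commutativeSemigroup public
    using () renaming (x∙yz≈y∙xz to *ₚ-x∙yz≈y∙xz)

  -ₚ-+ₚ : ∀ p q → -ₚ (p +ₚ q) ≐ -ₚ p +ₚ -ₚ q
  -ₚ-+ₚ p q = coeffwise λ k → begin
    coeff (-ₚ (p +ₚ q)) k                ≈⟨ coeff--ₚ (p +ₚ q) k ⟩
    - coeff (p +ₚ q) k                   ≈⟨ -‿cong (coeff-+ₚ p q k) ⟩
    - (coeff p k + coeff q k)            ≈⟨ ⁻¹-∙-comm _ _ ⟨
    - coeff p k + - coeff q k            ≈⟨ +-cong (coeff--ₚ p k) (coeff--ₚ q k) ⟨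
    coeff (-ₚ p) k + coeff (-ₚ q) k      ≈⟨ coeff-+ₚ (-ₚ p) (-ₚ q) k ⟨
    coeff (-ₚ p +ₚ -ₚ q) k               ∎

  -ₚ-scale : ∀ a q → -ₚ (scale a q) ≐ scale (- a) q
  -ₚ-scale a q = coeffwise λ k →
    trans (coeff--ₚ (scale a q) k) (trans (-‿cong (coeff-scale a q k)) (trans (-‿distribˡ-* _ _) (sym (coeff-scale (- a) q k))))

  -ₚ-*ₚ : ∀ p q → -ₚ (p *ₚ q) ≐ (-ₚ p) *ₚ q
  -ₚ-*ₚ []      q = ≐-refl
  -ₚ-*ₚ (a ∷ p) q = ≐-trans (-ₚ-+ₚ (scale a q) (shift (p *ₚ q)))
    (+ₚ-cong (-ₚ-scale a q) (∷-cong ε⁻¹≈ε (-ₚ-*ₚ p q)))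

  coeff-drop : ∀ m p i → coeff (drop m p) i ≡ coeff p (m ℕ.+ i)
  coeff-drop zero    p       i = ≡.refl
  coeff-drop (suc m) []      i = ≡.refl
  coeff-drop (suc m) (a ∷ p) i = coeff-drop m p i

  coeff-≥length : ∀ p {k} → length p ≤ k → coeff p k ≡ 0#
  coeff-≥length []      _         = ≡.refl
  coeff-≥length (a ∷ p) (s≤s p≤k) = coeff-≥length p p≤k

module Determinants (K : DecField) where
  open DecField K hiding (zero)
  open Polynomials K

  PolyMat : ℕ → Set
  PolyMat n = Fin n → Fin n → Poly

  det : ∀ n → PolyMat n → Poly
  det = Defs.detₚ K

  altSign : ℕ → Poly → Poly
  altSign = Defs.altSign K

  altSign-cong : ∀ k {p q} → p ≐ q → altSign k p ≐ altSign k q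
  altSign-cong zero    e = e
  altSign-cong (suc k) e = -ₚ-cong (altSign-cong k e)

  altSign-*ₚ : ∀ k p q → altSign k (p *ₚ q) ≐ altSign k p *ₚ q
  altSign-*ₚ zero    p q = ≐-refl
  altSign-*ₚ (suc k) p q = ≐-trans (-ₚ-cong (altSign-*ₚ k p q)) (-ₚ-*ₚ (altSign k p) q)

  altSign-[] : ∀ k → altSign k [] ≡ []
  altSign-[] zero    = ≡.refl
  altSign-[] (suc k) = ≡.cong -ₚ_ (altSign-[] k)

  sumMap : {A : Set} → (A → Poly) → List A → Poly
  sumMap T = foldr (λ x acc → T x +ₚ acc) []

  sumMap-++ : {A : Set} (T : A → Poly) (xs ys : List A) → sumMap T (xs ++ ys) ≐ sumMap T xs +ₚ sumMap T ys
  sumMap-++ T []       ys = ≐-refl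
  sumMap-++ T (x ∷ xs) ys =
    ≐-trans (+ₚ-cong ≐-refl (sumMap-++ T xs ys)) (≐-sym (+ₚ-assoc (T x) (sumMap T xs) (sumMap T ys)))

  sumMap-*ₚ : {A : Set} (T : A → Poly) (xs : List A) (q : Poly) → sumMap T xs *ₚ q ≐ sumMap (λ x → T x *ₚ q) xs
  sumMap-*ₚ T []       q = ≐-refl
  sumMap-*ₚ T (x ∷ xs) q = ≐-trans (*ₚ-distribʳ (T x) (sumMap T xs) q) (+ₚ-cong ≐-refl (sumMap-*ₚ T xs q))

  sumMap-tabulate-cong : ∀ {A B : Set} n (S : A → Poly) (T : B → Poly) (f : Fin n → A) (g : Fin n → B) →
                         (∀ i → S (f i) ≐ T (g i)) → sumMap S (tabulate f) ≐ sumMap T (tabulate g)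
  sumMap-tabulate-cong zero    S T f g e = ≐-refl
  sumMap-tabulate-cong (suc n) S T f g e = +ₚ-cong (e zero) (sumMap-tabulate-cong n S T (f ∘ suc) (g ∘ suc) (e ∘ suc))

  sumMap-tabulate-≐[] : ∀ {A : Set} n (T : A → Poly) (f : Fin n → A) → (∀ i → T (f i) ≐ []) → sumMap T (tabulate f) ≐ []
  sumMap-tabulate-≐[] zero    T f e = ≐-refl
  sumMap-tabulate-≐[] (suc n) T f e = +ₚ-cong (e zero) (sumMap-tabulate-≐[] n T (f ∘ suc) (e ∘ suc))

  tabulate-↑ : ∀ {A : Set} a b (f : Fin (a ℕ.+ b) → A) →
               tabulate f ≡ tabulate (f ∘ (_↑ˡ b)) ++ tabulate (f ∘ (a ↑ʳ_))
  tabulate-↑ zero    b f = ≡.refl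
  tabulate-↑ (suc a) b f = ≡.cong (f zero ∷_) (tabulate-↑ a b (f ∘ suc))

  minor : ∀ {n} → PolyMat (suc n) → Fin (suc n) → PolyMat n
  minor A j i k = A (suc i) (punchIn j k)

  laplaceTerm : ∀ {n} → PolyMat (suc n) → Fin (suc n) → Poly
  laplaceTerm {n} A j = altSign (toℕ j) (A zero j *ₚ det n (minor A j))

  det-cong : ∀ n {A B : PolyMat n} → (∀ i j → A i j ≐ B i j) → det n A ≐ det n B
  det-cong zero    e = ≐-refl
  det-cong (suc n) e = sumMap-tabulate-cong (suc n) _ _ id id λ j →
    altSign-cong (toℕ j) (*ₚ-cong (e zero j) (det-cong n λ i k → e (suc i) (punchIn j k)))

  blockEntry : ∀ {a b} → PolyMat a → PolyMat b → Fin a ⊎ Fin b → Fin a ⊎ Fin b → Poly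
  blockEntry M N (inj₁ i) (inj₁ j) = M i j
  blockEntry M N (inj₂ i) (inj₂ j) = N i j
  blockEntry M N (inj₁ i) (inj₂ j) = []
  blockEntry M N (inj₂ i) (inj₁ j) = []

  blockDiagₚ : ∀ a {b} → PolyMat a → PolyMat b → PolyMat (a ℕ.+ b)
  blockDiagₚ a M N i j = blockEntry M N (splitAt a i) (splitAt a j)

  splitAt-punchIn-↑ˡ : ∀ a b (j : Fin (suc a)) (k : Fin (a ℕ.+ b)) →
                       splitAt (suc a) (punchIn (j ↑ˡ b) k) ≡ Sum.map (punchIn j) id (splitAt a k)
  splitAt-punchIn-↑ˡ a b zero k with splitAt a k
  ... | inj₁ _ = ≡.refl
  ... | inj₂ _ = ≡.refl
  splitAt-punchIn-↑ˡ (suc a) b (suc j) zero    = ≡.refl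
  splitAt-punchIn-↑ˡ (suc a) b (suc j) (suc k) rewrite splitAt-punchIn-↑ˡ a b j k with splitAt a k
  ... | inj₁ _ = ≡.refl
  ... | inj₂ _ = ≡.refl

  minor-blockDiagₚ : ∀ a b (M : PolyMat (suc a)) (N : PolyMat b) (j : Fin (suc a)) i k →
                     minor (blockDiagₚ (suc a) M N) (j ↑ˡ b) i k ≡ blockDiagₚ a (minor M j) N i k
  minor-blockDiagₚ a b M N j i k rewrite splitAt-punchIn-↑ˡ a b j k with splitAt a i | splitAt a k
  ... | inj₁ _ | inj₁ _ = ≡.refl
  ... | inj₁ _ | inj₂ _ = ≡.refl
  ... | inj₂ _ | inj₁ _ = ≡.refl
  ... | inj₂ _ | inj₂ _ = ≡.refl

  det-blockDiagₚ : ∀ a b (M : PolyMat a) (N : PolyMat b) → det (a ℕ.+ b) (blockDiagₚ a M N) ≐ det a M *ₚ det b N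
  det-blockDiagₚ zero    b M N = ≐-sym (*ₚ-identityˡ (det b N))
  det-blockDiagₚ (suc a) b M N = begin
    sumMap T (tabulate id)
      ≡⟨ ≡.cong (sumMap T) (tabulate-↑ (suc a) b id) ⟩
    sumMap T (tabulate (_↑ˡ b) ++ tabulate (suc a ↑ʳ_))
      ≈⟨ sumMap-++ T (tabulate (_↑ˡ b)) (tabulate (suc a ↑ʳ_)) ⟩
    sumMap T (tabulate (_↑ˡ b)) +ₚ sumMap T (tabulate (suc a ↑ʳ_))
      ≈⟨ +ₚ-zeroʳ _ (sumMap-tabulate-≐[] b T (suc a ↑ʳ_) rightTerm) ⟩
    sumMap T (tabulate (_↑ˡ b))
      ≈⟨ sumMap-tabulate-cong (suc a) T (λ j → laplaceTerm M j *ₚ det b N) (_↑ˡ b) id leftTerm ⟩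
    sumMap (λ j → laplaceTerm M j *ₚ det b N) (tabulate id)
      ≈⟨ sumMap-*ₚ (laplaceTerm M) (tabulate id) (det b N) ⟨
    det (suc a) M *ₚ det b N ∎
    where
    open ≐-Reasoning
    T : Fin (suc a ℕ.+ b) → Poly
    T = laplaceTerm (blockDiagₚ (suc a) M N)
    rightTerm : ∀ j → T (suc a ↑ʳ j) ≐ []
    rightTerm j rewrite splitAt-↑ʳ (suc a) b j = ≐-reflexive (altSign-[] (toℕ (suc a ↑ʳ j)))
    leftTerm : ∀ j → T (j ↑ˡ b) ≐ laplaceTerm M j *ₚ det b N
    leftTerm j rewrite toℕ-↑ˡ j b | splitAt-↑ˡ (suc a) j b = begin
      altSign (toℕ j) (M zero j *ₚ det (a ℕ.+ b) (minor (blockDiagₚ (suc a) M N) (j ↑ˡ b)))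
        ≈⟨ altSign-cong (toℕ j) (*ₚ-cong (≐-refl {M zero j})
             (det-cong (a ℕ.+ b) λ i k → ≐-reflexive (minor-blockDiagₚ a b M N j i k))) ⟩
      altSign (toℕ j) (M zero j *ₚ det (a ℕ.+ b) (blockDiagₚ a (minor M j) N))
        ≈⟨ altSign-cong (toℕ j) (*ₚ-cong (≐-refl {M zero j}) (det-blockDiagₚ a b (minor M j) N)) ⟩
      altSign (toℕ j) (M zero j *ₚ (det a (minor M j) *ₚ det b N))
        ≈⟨ altSign-cong (toℕ j) (≐-sym (*ₚ-assoc (M zero j) _ (det b N))) ⟩
      altSign (toℕ j) (M zero j *ₚ det a (minor M j) *ₚ det b N)
        ≈⟨ altSign-*ₚ (toℕ j) _ (det b N) ⟩
      laplaceTerm M j *ₚ det b N ∎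

  X : Poly
  X = 0# ∷ 1# ∷ []

  charEntry : Bool → Carrier → Poly
  charEntry onDiagonal a = (if onDiagonal then X else []) +ₚ [ - a ]

  charMatrix : ∀ {n} → Mat K n → PolyMat n
  charMatrix A i j = charEntry (does (i Fin.≟ j)) (A i j)

  charPoly : ∀ {n} → Mat K n → Poly
  charPoly = Defs.charPoly K

  charMatrix-blockDiag₂ : ∀ {a b} (A : Mat K a) (B : Mat K b) i j →
                          charMatrix (blockDiag₂ K A B) i j ≐ blockDiagₚ a (charMatrix A) (charMatrix B) i j
  charMatrix-blockDiag₂ {a} {b} A B i j =
    ≡.subst₂ (λ i j → charMatrix (blockDiag₂ K A B) i j ≐ blockDiagₚ a (charMatrix A) (charMatrix B) i j)
             (join-splitAt a b i) (join-splitAt a b j) (atJoin (splitAt a i) (splitAt a j))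
    where
    atJoin : ∀ x y → charMatrix (blockDiag₂ K A B) (join a b x) (join a b y)
                     ≐ blockDiagₚ a (charMatrix A) (charMatrix B) (join a b x) (join a b y)
    atJoin (inj₁ x) (inj₁ y) rewrite splitAt-↑ˡ a x b | splitAt-↑ˡ a y b =
      ≐-reflexive (≡.cong (λ d → charEntry d (A x y))
        (does-⇔ (mk⇔ (↑ˡ-injective b x y) (≡.cong (_↑ˡ b))) (x ↑ˡ b Fin.≟ y ↑ˡ b) (x Fin.≟ y)))
    atJoin (inj₂ x) (inj₂ y) rewrite splitAt-↑ʳ a b x | splitAt-↑ʳ a b y =
      ≐-reflexive (≡.cong (λ d → charEntry d (B x y))
        (does-⇔ (mk⇔ (↑ʳ-injective a x y) (≡.cong (a ↑ʳ_))) (a ↑ʳ x Fin.≟ a ↑ʳ y) (x Fin.≟ y)))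
    atJoin (inj₁ x) (inj₂ y) rewrite splitAt-↑ˡ a x b | splitAt-↑ʳ a b y
                                   | dec-false (x ↑ˡ b Fin.≟ a ↑ʳ y) (↑ˡ≢↑ʳ x y) = [-0]≐[]
    atJoin (inj₂ x) (inj₁ y) rewrite splitAt-↑ʳ a b x | splitAt-↑ˡ a y b
                                   | dec-false (a ↑ʳ x Fin.≟ y ↑ˡ b) (↑ˡ≢↑ʳ y x ∘ ≡.sym) = [-0]≐[]

  charPoly-blockDiag₂ : ∀ {a b} (A : Mat K a) (B : Mat K b) → charPoly (blockDiag₂ K A B) ≐ charPoly A *ₚ charPoly B
  charPoly-blockDiag₂ {a} {b} A B =
    ≐-trans (det-cong (a ℕ.+ b) (charMatrix-blockDiag₂ A B)) (det-blockDiagₚ a b (charMatrix A) (charMatrix B))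

  charPolyProduct : ∀ m (ns : Fin m → ℕ) → ((i : Fin m) → Mat K (ns i)) → Poly
  charPolyProduct zero    ns g = [ 1# ]
  charPolyProduct (suc m) ns g = charPoly (g zero) *ₚ charPolyProduct m (ns ∘ suc) (g ∘ suc)

  charPoly-blockDiag : ∀ m ns g → charPoly (blockDiag K m ns g) ≐ charPolyProduct m ns g
  charPoly-blockDiag zero    ns g = ≐-refl
  charPoly-blockDiag (suc m) ns g = ≐-trans (charPoly-blockDiag₂ (g zero) _)
    (*ₚ-cong (≐-refl {charPoly (g zero)}) (charPoly-blockDiag m (ns ∘ suc) (g ∘ suc)))

  charPoly-∣-charPolyProduct : ∀ m ns (g : (i : Fin m) → Mat K (ns i)) i →
                               ∃ λ q → charPoly (g i) *ₚ q ≐ charPolyProduct m ns g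
  charPoly-∣-charPolyProduct (suc m) ns g zero    = charPolyProduct m (ns ∘ suc) (g ∘ suc) , ≐-refl
  charPoly-∣-charPolyProduct (suc m) ns g (suc i) with charPoly-∣-charPolyProduct m (ns ∘ suc) (g ∘ suc) i
  ... | q , gᵢq≐rest = charPoly (g zero) *ₚ q ,
      ≐-trans (*ₚ-x∙yz≈y∙xz (charPoly (g (suc i))) (charPoly (g zero)) q) (*ₚ-cong (≐-refl {charPoly (g zero)}) gᵢq≐rest)

module Degrees (K : DecField) where
  open DecField K hiding (zero)
  open import Algebra.Properties.Group +-group using (ε⁻¹≈ε)
  open Polynomials K
  open Determinants K

  record DegreeAtMost (d : ℕ) (p : Poly) : Set where
    constructor vanishesAbove
    field coeff-above : ∀ j → d < j → coeff p j ≈ 0#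
  open DegreeAtMost public

  Monic : ℕ → Poly → Set
  Monic d p = DegreeAtMost d p × coeff p d ≈ 1#


  degree-mono : ∀ {d e p} → d ≤ e → DegreeAtMost d p → DegreeAtMost e p
  degree-mono d≤e D = vanishesAbove λ j e<j → coeff-above D j (ℕₚ.≤-<-trans d≤e e<j)

  degree-[] : ∀ d → DegreeAtMost d []
  degree-[] d = vanishesAbove λ _ _ → refl

  degree-[a] : ∀ a → DegreeAtMost 0 [ a ]
  degree-[a] a = vanishesAbove λ { (suc j) _ → refl }

  monic-[1] : Monic 0 [ 1# ]
  monic-[1] = degree-[a] 1# , refl

  degree-+ₚ : ∀ {d p q} → DegreeAtMost d p → DegreeAtMost d q → DegreeAtMost d (p +ₚ q)
  degree-+ₚ {p = p} {q} Dp Dq = vanishesAbove λ j d<j →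
    trans (coeff-+ₚ p q j) (trans (+-cong (coeff-above Dp j d<j) (coeff-above Dq j d<j)) (+-identityˡ 0#))

  degree--ₚ : ∀ {d p} → DegreeAtMost d p → DegreeAtMost d (-ₚ p)
  degree--ₚ {p = p} D = vanishesAbove λ j d<j → trans (coeff--ₚ p j) (trans (-‿cong (coeff-above D j d<j)) ε⁻¹≈ε)

  degree-altSign : ∀ k {d p} → DegreeAtMost d p → DegreeAtMost d (altSign k p)
  degree-altSign zero    D = D
  degree-altSign (suc k) D = degree--ₚ (degree-altSign k D)

  degree-sumMap-tabulate : ∀ {A : Set} {d} n (T : A → Poly) (f : Fin n → A) →
                           (∀ i → DegreeAtMost d (T (f i))) → DegreeAtMost d (sumMap T (tabulate f))
  degree-sumMap-tabulate zero    T f D = degree-[] _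
  degree-sumMap-tabulate (suc n) T f D = degree-+ₚ (D zero) (degree-sumMap-tabulate n T (f ∘ suc) (D ∘ suc))

  convolution-above : ∀ a b {f g} → (∀ j → a < j → f j ≈ 0#) → (∀ j → b < j → g j ≈ 0#) →
                      ∀ k → a ℕ.+ b < k → convolution f g k ≈ 0#
  convolution-above zero b {f} {g} f↑ g↑ (suc k) (s≤s b<k) =
    trans (+-cong (trans (*-cong refl (g↑ (suc k) (s≤s b<k))) (zeroʳ _))
                  (convolution-zeroˡ g (λ i → f↑ (suc i) (s≤s z≤n)) k))
          (+-identityˡ 0#)
  convolution-above (suc a) b {f} {g} f↑ g↑ (suc k) (s≤s a+b<k) =
    trans (+-cong (trans (*-cong refl (g↑ (suc k) (s≤s (ℕₚ.≤-trans (ℕₚ.m≤n+m b a) (ℕₚ.<⇒≤ a+b<k))))) (zeroʳ _))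
                  (convolution-above a b (λ j a<j → f↑ (suc j) (s≤s a<j)) g↑ k a+b<k))
          (+-identityˡ 0#)

  convolution-top : ∀ a b {f g} → (∀ j → a < j → f j ≈ 0#) → (∀ j → b < j → g j ≈ 0#) →
                    convolution f g (a ℕ.+ b) ≈ f a * g b
  convolution-top zero zero          f↑ g↑ = refl
  convolution-top zero (suc b) {f} {g} f↑ g↑ =
    trans (+-cong refl (convolution-zeroˡ g (λ i → f↑ (suc i) (s≤s z≤n)) b)) (+-identityʳ _)
  convolution-top (suc a) b {f} {g} f↑ g↑ =
    trans (+-cong (trans (*-cong refl (g↑ (suc (a ℕ.+ b)) (s≤s (ℕₚ.m≤n+m b a)))) (zeroʳ _))
                  (convolution-top a b (λ j a<j → f↑ (suc j) (s≤s a<j)) g↑))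
          (+-identityˡ _)

  degree-*ₚ : ∀ {a b p q} → DegreeAtMost a p → DegreeAtMost b q → DegreeAtMost (a ℕ.+ b) (p *ₚ q)
  degree-*ₚ {a} {b} {p} {q} Dp Dq = vanishesAbove λ j a+b<j →
    trans (coeff-*ₚ p q j) (convolution-above a b (coeff-above Dp) (coeff-above Dq) j a+b<j)

  monic-*ₚ : ∀ {a b p q} → Monic a p → Monic b q → Monic (a ℕ.+ b) (p *ₚ q)
  monic-*ₚ {a} {b} {p} {q} (Dp , lcp) (Dq , lcq) = degree-*ₚ Dp Dq ,
    trans (coeff-*ₚ p q (a ℕ.+ b))
          (trans (convolution-top a b (coeff-above Dp) (coeff-above Dq)) (trans (*-cong lcp lcq) (*-identityˡ 1#)))

  monic-+ₚ-lower : ∀ {d e p q} → Monic d p → DegreeAtMost e q → e < d → Monic d (p +ₚ q)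
  monic-+ₚ-lower {d} {p = p} {q} (Dp , lcp) Dq e<d =
    degree-+ₚ Dp (degree-mono (ℕₚ.<⇒≤ e<d) Dq) ,
    trans (coeff-+ₚ p q d) (trans (+-cong lcp (coeff-above Dq d e<d)) (+-identityʳ 1#))

  det-degree : ∀ n (M : PolyMat n) → (∀ i j → DegreeAtMost 1 (M i j)) → DegreeAtMost n (det n M)
  det-degree zero    M D = degree-[a] 1#
  det-degree (suc n) M D = degree-sumMap-tabulate (suc n) (laplaceTerm M) id λ j →
    degree-altSign (toℕ j) (degree-*ₚ (D zero j) (det-degree n (minor M j) (λ i k → D (suc i) (punchIn j k))))

  -- Only the diagonal term of the Laplace expansion reaches degree n: the others
  -- multiply a constant by a minor of degree at most n - 1.
  det-monic : ∀ n (M : PolyMat n) → (∀ i → Monic 1 (M i i)) → (∀ i j → i ≢ j → DegreeAtMost 0 (M i j)) →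
              Monic n (det n M)
  det-monic zero    M diag offDiag = monic-[1]
  det-monic (suc n) M diag offDiag =
    monic-+ₚ-lower
      (monic-*ₚ (diag zero) (det-monic n (minor M zero) (diag ∘ suc) (λ i j i≢j → offDiag (suc i) (suc j) (i≢j ∘ suc-injective))))
      (degree-sumMap-tabulate n (laplaceTerm M) suc λ j →
        degree-altSign (toℕ (suc j)) (degree-*ₚ (offDiag zero (suc j) λ ()) (det-degree n (minor M (suc j)) (λ i k → entry (suc i) _))))
      (ℕₚ.n<1+n n)
    where
    entry : ∀ i j → DegreeAtMost 1 (M i j)
    entry i j with i Fin.≟ j
    ... | yes ≡.refl = proj₁ (diag i)
    ... | no i≢j     = degree-mono z≤n (offDiag i j i≢j)

  charPoly-monic : ∀ {n} (A : Mat K n) → Monic n (charPoly A)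
  charPoly-monic {n} A = det-monic n (charMatrix A) diag offDiag
    where
    diag : ∀ i → Monic 1 (charMatrix A i i)
    diag i rewrite dec-true (i Fin.≟ i) ≡.refl =
      vanishesAbove (λ { (suc (suc j)) _ → refl ; (suc zero) (s≤s ()) }) , refl
    offDiag : ∀ i j → i ≢ j → DegreeAtMost 0 (charMatrix A i j)
    offDiag i j i≢j rewrite dec-false (i Fin.≟ j) i≢j = degree-[a] _

module LinearFactors (K : DecField) where
  open DecField K hiding (zero)
  open Polynomials K
  open Degrees K
  open import Algebra.Properties.Group +-group using (∙-cancelˡ)
  open SemiringSolver (CommutativeRing.commutativeSemiring commRing) using (solve; _:=_; _:+_; _:*_)
  open import Algebra.Properties.Ring (CommutativeRing.ring commRing) using (-‿distribˡ-*)

  eval : Poly → Carrier → Carrier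
  eval = Defs.evalₚ K

  eval-≐[] : ∀ p x → p ≐ [] → eval p x ≈ 0#
  eval-≐[] []      x e = refl
  eval-≐[] (a ∷ p) x e =
    trans (+-cong (coeff-≈ e 0) (*-cong refl (eval-≐[] p x (coeffwise (coeff-≈ e ∘ suc))))) (trans (+-identityˡ _) (zeroʳ x))

  eval-cong : ∀ {p q} x → p ≐ q → eval p x ≈ eval q x
  eval-cong {[]}    {q}     x e = sym (eval-≐[] q x (≐-sym e))
  eval-cong {a ∷ p} {[]}    x e = eval-≐[] (a ∷ p) x e
  eval-cong {a ∷ p} {b ∷ q} x e = +-cong (coeff-≈ e 0) (*-cong refl (eval-cong x (∷-injectiveʳ e)))

  eval-+ₚ : ∀ p q x → eval (p +ₚ q) x ≈ eval p x + eval q x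
  eval-+ₚ []      q       x = sym (+-identityˡ _)
  eval-+ₚ (a ∷ p) []      x = sym (+-identityʳ _)
  eval-+ₚ (a ∷ p) (b ∷ q) x = begin
    a + b + x * eval (p +ₚ q) x           ≈⟨ +-cong refl (*-cong refl (eval-+ₚ p q x)) ⟩
    a + b + x * (eval p x + eval q x)     ≈⟨ solve 5 (λ a b x u v → a :+ b :+ x :* (u :+ v) := (a :+ x :* u) :+ (b :+ x :* v))
                                                    refl a b x (eval p x) (eval q x) ⟩
    a + x * eval p x + (b + x * eval q x) ∎
    where open SetoidReasoning setoid

  eval-scale : ∀ a p x → eval (scale a p) x ≈ a * eval p x
  eval-scale a []      x = sym (zeroʳ a)
  eval-scale a (b ∷ p) x = begin
    a * b + x * eval (scale a p) x ≈⟨ +-cong refl (*-cong refl (eval-scale a p x)) ⟩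
    a * b + x * (a * eval p x)     ≈⟨ solve 4 (λ a b x u → a :* b :+ x :* (a :* u) := a :* (b :+ x :* u)) refl a b x (eval p x) ⟩
    a * (b + x * eval p x)         ∎
    where open SetoidReasoning setoid

  eval-*ₚ : ∀ p q x → eval (p *ₚ q) x ≈ eval p x * eval q x
  eval-*ₚ []      q x = sym (zeroˡ _)
  eval-*ₚ (a ∷ p) q x = begin
    eval (scale a q +ₚ shift (p *ₚ q)) x       ≈⟨ eval-+ₚ (scale a q) (shift (p *ₚ q)) x ⟩
    eval (scale a q) x + (0# + x * eval (p *ₚ q) x)
      ≈⟨ +-cong (eval-scale a q x) (trans (+-identityˡ _) (*-cong refl (eval-*ₚ p q x))) ⟩
    a * eval q x + x * (eval p x * eval q x)   ≈⟨ solve 4 (λ a x u v → a :* v :+ x :* (u :* v) := (a :+ x :* u) :* v)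
                                                         refl a x (eval p x) (eval q x) ⟩
    (a + x * eval p x) * eval q x              ∎
    where open SetoidReasoning setoid

  eval-[1] : ∀ x → eval [ 1# ] x ≈ 1#
  eval-[1] x = trans (+-cong refl (zeroʳ x)) (+-identityʳ 1#)

  *-nonzeroˡ⇒zero : ∀ a b → a * b ≈ 0# → ¬ (a ≈ 0#) → b ≈ 0#
  *-nonzeroˡ⇒zero a b ab≈0 a≉0 with inverse a a≉0
  ... | a⁻¹ , aa⁻¹≈1 = begin
    b               ≈⟨ *-identityˡ b ⟨
    1# * b          ≈⟨ *-cong aa⁻¹≈1 refl ⟨
    a * a⁻¹ * b     ≈⟨ solve 3 (λ a a⁻¹ b → a :* a⁻¹ :* b := a⁻¹ :* (a :* b)) refl a a⁻¹ b ⟩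
    a⁻¹ * (a * b)   ≈⟨ *-cong refl ab≈0 ⟩
    a⁻¹ * 0#        ≈⟨ zeroʳ a⁻¹ ⟩
    0#              ∎
    where open SetoidReasoning setoid

  -xy+[z+xy]≈z : ∀ x y z → - x * y + (z + x * y) ≈ z
  -xy+[z+xy]≈z x y z = begin
    - x * y + (z + x * y)        ≈⟨ solve 3 (λ u z v → u :+ (z :+ v) := z :+ (u :+ v)) refl (- x * y) z (x * y) ⟩
    z + (- x * y + x * y)        ≈⟨ +-cong refl (trans (+-cong (sym (-‿distribˡ-* x y)) refl) (-‿inverseˡ _)) ⟩
    z + 0#                       ≈⟨ +-identityʳ z ⟩
    z                            ∎
    where open SetoidReasoning setoid

  linearFactor : Carrier → Poly
  linearFactor l = - l ∷ 1# ∷ []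

  linearFactor-*ₚ : ∀ l q → linearFactor l *ₚ q ≐ scale (- l) q +ₚ shift q
  linearFactor-*ₚ l q = +ₚ-cong (≐-refl {scale (- l) q}) (∷-cong refl (*ₚ-identityˡ q))

  coeff-linearFactor-*ₚ : ∀ l q k → coeff (linearFactor l *ₚ q) (suc k) ≈ - l * coeff q (suc k) + coeff q k
  coeff-linearFactor-*ₚ l q k =
    trans (coeff-≈ (linearFactor-*ₚ l q) (suc k)) (trans (coeff-+ₚ (scale (- l) q) (shift q) (suc k)) (+-cong (coeff-scale (- l) q (suc k)) refl))

  -- Synthetic division (Horner): the coefficients of the quotient by x - l are values at l of tails of p.
  quotient : Carrier → Poly → Poly
  quotient l []      = []
  quotient l (a ∷ p) = eval p l ∷ quotient l p

  coeff-quotient : ∀ l p k → coeff (quotient l p) k ≡ eval (drop (suc k) p) l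
  coeff-quotient l []      k       = ≡.refl
  coeff-quotient l (a ∷ p) zero    = ≡.refl
  coeff-quotient l (a ∷ p) (suc k) = coeff-quotient l p k

  division : ∀ l p → p ≐ linearFactor l *ₚ quotient l p +ₚ [ eval p l ]
  division l []      = ≐-sym (≐-trans (+ₚ-cong (*ₚ-zeroʳ (linearFactor l)) ≐-refl) [0]≐[])
  division l (a ∷ p) = ≐-sym (begin
    linearFactor l *ₚ (e ∷ q) +ₚ [ a + l * e ]
      ≈⟨ +ₚ-cong (linearFactor-*ₚ l (e ∷ q)) (≐-refl {[ a + l * e ]}) ⟩
    (- l * e + 0# + (a + l * e)) ∷ (scale (- l) q +ₚ (e ∷ q) +ₚ [])
      ≈⟨ ∷-cong head (≐-reflexive (+ₚ-identityʳ _)) ⟩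
    a ∷ (scale (- l) q +ₚ (e ∷ q))
      ≈⟨ ∷-cong refl (+ₚ-cong (≐-refl {scale (- l) q}) (∷-split e q)) ⟩
    a ∷ (scale (- l) q +ₚ ([ e ] +ₚ shift q))
      ≈⟨ ∷-cong refl (+ₚ-x∙yz≈xz∙y (scale (- l) q) [ e ] (shift q)) ⟩
    a ∷ (scale (- l) q +ₚ shift q +ₚ [ e ])
      ≈⟨ ∷-cong refl (≐-sym (+ₚ-cong (linearFactor-*ₚ l q) ≐-refl)) ⟩
    a ∷ (linearFactor l *ₚ q +ₚ [ e ])
      ≈⟨ ∷-cong refl (≐-sym (division l p)) ⟩
    a ∷ p ∎)
    where
    open ≐-Reasoning
    e : Carrier
    e = eval p l
    q : Poly
    q = quotient l p
    head : - l * e + 0# + (a + l * e) ≈ a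
    head = trans (+-cong (+-identityʳ _) refl) (-xy+[z+xy]≈z l e a)

  factor-theorem : ∀ l p → eval p l ≈ 0# → p ≐ linearFactor l *ₚ quotient l p
  factor-theorem l p root = ≐-trans (division l p) (+ₚ-zeroʳ _ (≐-trans (∷-cong root ≐-refl) [0]≐[]))

  drop-≐[] : ∀ {d p} m → DegreeAtMost d p → d < m → drop m p ≐ []
  drop-≐[] {p = p} m D d<m = coeffwise λ i →
    ≡.subst (_≈ 0#) (≡.sym (coeff-drop m p i)) (coeff-above D (m ℕ.+ i) (ℕₚ.≤-trans d<m (ℕₚ.m≤m+n m i)))

  monic-drop : ∀ m {d p} → Monic (m ℕ.+ d) p → Monic d (drop m p)
  monic-drop m {d} {p} (D , lc) =
    vanishesAbove (λ j d<j → ≡.subst (_≈ 0#) (≡.sym (coeff-drop m p j)) (coeff-above D (m ℕ.+ j) (ℕₚ.+-monoʳ-< m d<j))) ,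
    ≡.subst (_≈ 1#) (≡.sym (coeff-drop m p d)) lc

  monic₀-≐[1] : ∀ {p} → Monic 0 p → p ≐ [ 1# ]
  monic₀-≐[1] (D , lc) = coeffwise λ { zero → lc ; (suc k) → coeff-above D (suc k) (s≤s z≤n) }

  quotient-monic : ∀ l {n p} → Monic (suc n) p → Monic n (quotient l p)
  quotient-monic l {n} {p} M =
    vanishesAbove (λ j n<j → via-eval j (eval-≐[] _ l (drop-≐[] (suc j) (proj₁ M) (s≤s n<j)))) ,
    via-eval n (trans (eval-cong l (monic₀-≐[1] (monic-drop (suc n) M+0))) (eval-[1] l))
    where
    M+0 : Monic (suc n ℕ.+ 0) p
    M+0 = ≡.subst (λ d → Monic d p) (≡.sym (ℕₚ.+-identityʳ (suc n))) M
    via-eval : ∀ {c} k → eval (drop (suc k) p) l ≈ c → coeff (quotient l p) k ≈ c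
    via-eval k = ≡.subst (_≈ _) (≡.sym (coeff-quotient l p k))

  -- Brings a monic polynomial into the shape required by AlgClosed.
  lowerCoeffs : ℕ → Poly → List Carrier
  lowerCoeffs zero    p = []
  lowerCoeffs (suc d) p = coeff p 0 ∷ lowerCoeffs d (drop 1 p)

  ≐-∷-drop₁ : ∀ p → p ≐ coeff p 0 ∷ drop 1 p
  ≐-∷-drop₁ []      = ≐-sym [0]≐[]
  ≐-∷-drop₁ (a ∷ p) = ≐-refl

  monic-lowerCoeffs : ∀ d {p} → Monic d p → p ≐ lowerCoeffs d p ++ [ 1# ]
  monic-lowerCoeffs zero    M = monic₀-≐[1] M
  monic-lowerCoeffs (suc d) {p} M = ≐-trans (≐-∷-drop₁ p) (∷-cong refl (monic-lowerCoeffs d (monic-drop 1 M)))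

  monic-root : AlgClosed K → ∀ {d p} → Monic (suc d) p → ∃ λ x → eval p x ≈ 0#
  monic-root closed {d} {p} M with closed (coeff p 0) (lowerCoeffs d (drop 1 p))
  ... | x , root = x , trans (eval-cong x (monic-lowerCoeffs (suc d) M)) root

  -- Since the coefficient of x^(k+1) in (x - l)u is u_k - l u_(k+1), the coefficients
  -- of u are determined from the top down.
  linearFactor-cancel : ∀ l {u v} → linearFactor l *ₚ u ≐ linearFactor l *ₚ v → u ≐ v
  linearFactor-cancel l {u} {v} e = coeffwise λ k → agree N k (ℕₚ.m≤n+m N k)
    where
    N : ℕ
    N = length u ⊔ length v
    agree : ∀ t k → N ≤ k ℕ.+ t → coeff u k ≈ coeff v k
    agree zero k N≤k rewrite ℕₚ.+-identityʳ k =
      ≡.subst₂ _≈_ (≡.sym (coeff-≥length u (ℕₚ.≤-trans (ℕₚ.m≤m⊔n _ _) N≤k)))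
                   (≡.sym (coeff-≥length v (ℕₚ.≤-trans (ℕₚ.m≤n⊔m _ _) N≤k))) refl
    agree (suc t) k N≤k+1+t = ∙-cancelˡ (- l * coeff u (suc k)) _ _ (begin
      - l * coeff u (suc k) + coeff u k  ≈⟨ coeff-linearFactor-*ₚ l u k ⟨
      coeff (linearFactor l *ₚ u) (suc k) ≈⟨ coeff-≈ e (suc k) ⟩
      coeff (linearFactor l *ₚ v) (suc k) ≈⟨ coeff-linearFactor-*ₚ l v k ⟩
      - l * coeff v (suc k) + coeff v k  ≈⟨ +-cong (*-cong refl (agree t (suc k) (≡.subst (N ≤_) (ℕₚ.+-suc k t) N≤k+1+t))) refl ⟨
      - l * coeff u (suc k) + coeff v k  ∎)
      where open SetoidReasoning setoid

module MonicDivisors (K : DecField) (closed : AlgClosed K) where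
  open DecField K hiding (zero)
  open Polynomials K
  open Degrees K
  open LinearFactors K

  rootOf : ∀ {n f} → Monic (suc n) f → Carrier
  rootOf M = proj₁ (monic-root closed M)

  -- Split off a root l of f = (x - l) f′: a monic divisor of f divides f′ or is (x - l) times one.
  divisorCandidates : ∀ n f → Monic n f → List Poly
  divisorCandidates zero    f M = [ [ 1# ] ]
  divisorCandidates (suc n) f M = candidates ++ map (linearFactor (rootOf M) *ₚ_) candidates
    where
    candidates : List Poly
    candidates = divisorCandidates n (quotient (rootOf M) f) (quotient-monic (rootOf M) M)

  length-divisorCandidates : ∀ n f (M : Monic n f) → length (divisorCandidates n f M) ≡ 2 ^ n
  length-divisorCandidates zero    f M = ≡.refl
  length-divisorCandidates (suc n) f M = begin
    length (S ++ map (linearFactor l *ₚ_) S)       ≡⟨ length-++ S ⟩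
    length S ℕ.+ length (map (linearFactor l *ₚ_) S) ≡⟨ ≡.cong (length S ℕ.+_) (length-map _ S) ⟩
    length S ℕ.+ length S                          ≡⟨ ≡.cong (λ m → m ℕ.+ m) (length-divisorCandidates n _ _) ⟩
    2 ^ n ℕ.+ 2 ^ n                                ≡⟨ ≡.cong (2 ^ n ℕ.+_) (ℕₚ.+-identityʳ (2 ^ n)) ⟨
    2 ^ suc n                                      ∎
    where
    open ≡.≡-Reasoning
    l : Carrier
    l = rootOf M
    S : List Poly
    S = divisorCandidates n (quotient l f) (quotient-monic l M)

  [1]∈divisorCandidates : ∀ n f (M : Monic n f) → Any ([ 1# ] ≐_) (divisorCandidates n f M)
  [1]∈divisorCandidates zero    f M = here ≐-refl
  [1]∈divisorCandidates (suc n) f M = ++⁺ˡ ([1]∈divisorCandidates n _ _)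

  positiveDegree-∤-[1] : ∀ {d c k} → Monic (suc d) c → ¬ (c *ₚ k ≐ [ 1# ])
  positiveDegree-∤-[1] {c = c} {k} M ck≐1 with monic-root closed M
  ... | x , root = 1≉0 (begin
    1#                  ≈⟨ eval-[1] x ⟨
    eval [ 1# ] x       ≈⟨ eval-cong x ck≐1 ⟨
    eval (c *ₚ k) x     ≈⟨ eval-*ₚ c k x ⟩
    eval c x * eval k x ≈⟨ *-cong root refl ⟩
    0# * eval k x       ≈⟨ zeroˡ _ ⟩
    0#                  ∎)
    where open SetoidReasoning setoid

  divisorCandidates-complete : ∀ n f (M : Monic n f) {d c k} → Monic d c → c *ₚ k ≐ f →
                               Any (c ≐_) (divisorCandidates n f M)
  divisorCandidates-complete n f M {zero} Mc ck≐f =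
    Any.map (λ [1]≐s → ≐-trans (monic₀-≐[1] Mc) [1]≐s) ([1]∈divisorCandidates n f M)
  divisorCandidates-complete zero f M {suc d} Mc ck≐f =
    ⊥-elim (positiveDegree-∤-[1] Mc (≐-trans ck≐f (monic₀-≐[1] M)))
  divisorCandidates-complete (suc n) f M {suc d} {c} {k} Mc ck≐f = byRoot (eval c l ≟ 0#)
    where
    l : Carrier
    l = rootOf M
    f′ : Poly
    f′ = quotient l f
    M′ : Monic n f′
    M′ = quotient-monic l M
    f≐lf′ : f ≐ linearFactor l *ₚ f′
    f≐lf′ = factor-theorem l f (proj₂ (monic-root closed M))
    S : List Poly
    S = divisorCandidates n f′ M′
    byRoot : Dec (eval c l ≈ 0#) → Any (c ≐_) (S ++ map (linearFactor l *ₚ_) S)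
    byRoot (yes c[l]≈0) = ++⁺ʳ S (map⁺ (Any.map (λ c′≐s → ≐-trans c≐lc′ (*ₚ-cong (≐-refl {linearFactor l}) c′≐s))
                            (divisorCandidates-complete n f′ M′ (quotient-monic l Mc) (linearFactor-cancel l lc′k≐lf′))))
      where
      c′ : Poly
      c′ = quotient l c
      c≐lc′ : c ≐ linearFactor l *ₚ c′
      c≐lc′ = factor-theorem l c c[l]≈0
      lc′k≐lf′ : linearFactor l *ₚ (c′ *ₚ k) ≐ linearFactor l *ₚ f′
      lc′k≐lf′ = ≐-trans (≐-sym (*ₚ-assoc (linearFactor l) c′ k))
                 (≐-trans (*ₚ-cong (≐-sym c≐lc′) ≐-refl) (≐-trans ck≐f f≐lf′))
    byRoot (no c[l]≉0) = ++⁺ˡ (divisorCandidates-complete n f′ M′ Mc (linearFactor-cancel l lck′≐lf′))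
      where
      k[l]≈0 : eval k l ≈ 0#
      k[l]≈0 = *-nonzeroˡ⇒zero (eval c l) (eval k l)
                 (trans (sym (eval-*ₚ c k l)) (trans (eval-cong l ck≐f) (proj₂ (monic-root closed M)))) c[l]≉0
      k′ : Poly
      k′ = quotient l k
      lck′≐lf′ : linearFactor l *ₚ (c *ₚ k′) ≐ linearFactor l *ₚ f′
      lck′≐lf′ = ≐-trans (*ₚ-x∙yz≈y∙xz (linearFactor l) c k′)
                 (≐-trans (*ₚ-cong (≐-refl {c}) (≐-sym (factor-theorem l k k[l]≈0))) (≐-trans ck≐f f≐lf′))

module CharacteristicPolynomialCounts (K : DecField) where
  open DecField K using (_≈_; refl)
  open Polynomials K
  open Determinants K

  ≐⇒≈ₚ : ∀ {p q} → p ≐ q → Defs._≈ₚ_ K p q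
  ≐⇒≈ₚ p≐q = All.tabulate λ {k} _ → coeff-≈ p≐q k

  ≈ₚ⇒≐ : ∀ {p q} → Defs._≈ₚ_ K p q → p ≐ q
  ≈ₚ⇒≐ {p} {q} p≈q = coeffwise λ k → compare k (k ℕₚ.<? N)
    where
    N : ℕ
    N = length p ⊔ length q
    compare : ∀ k → Dec (k < N) → coeff p k ≈ coeff q k
    compare k (yes k<N) = All.lookup p≈q (∈-upTo⁺ k<N)
    compare k (no k≮N)  = ≡.subst₂ _≈_ (≡.sym (coeff-≥length p (ℕₚ.≤-trans (ℕₚ.m≤m⊔n _ _) (ℕₚ.≮⇒≥ k≮N))))
                                       (≡.sym (coeff-≥length q (ℕₚ.≤-trans (ℕₚ.m≤n⊔m _ _) (ℕₚ.≮⇒≥ k≮N)))) refl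

  infix 4 _≐?_
  _≐?_ : (p q : Poly) → Dec (p ≐ q)
  p ≐? q = map′ ≈ₚ⇒≐ ≐⇒≈ₚ (Defs._≟ₚ_ K p q)

  sameCharPoly≤MD : ∀ {n} s (L : List (Mat K n)) → length (filter (λ h → charPoly h ≐? s) L) ≤ MD K L
  sameCharPoly≤MD s L with Any.any? (λ h → charPoly h ≐? s) L
  ... | yes some = foldr-⊔-upper (MD-of K L) L (Any.map (λ χg≐s →
        length-filter-mono _ _ (λ χh≐s → ≐⇒≈ₚ (≐-trans χh≐s (≐-sym χg≐s))) L) some)
  ... | no none rewrite filter-none (λ h → charPoly h ≐? s) (AllP.¬Any⇒All¬ L none) = z≤n

  charPolyIn≤ : ∀ {n} (S : List Poly) (L : List (Mat K n)) →
                length (filter (λ h → Any.any? (charPoly h ≐?_) S) L) ≤ length S ℕ.* MD K L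
  charPolyIn≤ []      L rewrite filter-none (λ h → Any.any? (charPoly h ≐?_) []) (All.universal (λ _ ()) L) = z≤n
  charPolyIn≤ (s ∷ S) L = ℕₚ.≤-trans
    (length-filter-⊎ (λ h → charPoly h ≐? s) (λ h → Any.any? (charPoly h ≐?_) S) (λ h → Any.any? (charPoly h ≐?_) (s ∷ S))
                     (λ { (here χh≐s) → inj₁ χh≐s ; (there χh∈S) → inj₂ χh∈S }) L)
    (ℕₚ.+-mono-≤ (sameCharPoly≤MD s L) (charPolyIn≤ S L))

  length-filter-tuples : ∀ m (ns : Fin m → ℕ) (Ls : (i : Fin m) → List (Mat K (ns i)))
                         {R : Pred ((i : Fin m) → Mat K (ns i)) 0ℓ} (R? : U.Decidable R)
                         {P : (i : Fin m) → Pred (Mat K (ns i)) 0ℓ} (P? : ∀ i → U.Decidable (P i)) →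
                         (∀ {t} → R t → ∀ i → P i (t i)) →
                         length (filter R? (tuples K m ns Ls)) ≤ prodFin K m (λ i → length (filter (P? i) (Ls i)))
  length-filter-tuples zero    ns Ls R? P? R⇒P = length-filter R? (tuples K zero ns Ls)
  length-filter-tuples (suc m) ns Ls R? P? R⇒P =
    length-filter-concatMap (P? zero) R? _ (tuples K m (ns ∘ suc) (Ls ∘ suc))
      (λ _ → length-filter-tuples m (ns ∘ suc) (Ls ∘ suc) _ (P? ∘ suc) (λ r i → R⇒P r (suc i)))
      (λ r → R⇒P r zero) (Ls zero)

  prodFin-mono : ∀ m {f g : Fin m → ℕ} → (∀ i → f i ≤ g i) → prodFin K m f ≤ prodFin K m g
  prodFin-mono zero    f≤g = ℕₚ.≤-refl
  prodFin-mono (suc m) f≤g = ℕₚ.*-mono-≤ (f≤g zero) (prodFin-mono m (f≤g ∘ suc))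

  prodFin-scale : ∀ m a (f : Fin m → ℕ) → prodFin K m (λ i → a ℕ.* f i) ≡ a ^ m ℕ.* prodFin K m f
  prodFin-scale zero    a f = ≡.refl
  prodFin-scale (suc m) a f rewrite prodFin-scale m a (f ∘ suc) =
    solve 4 (λ a x b p → (a :* x) :* (b :* p) := (a :* b) :* (x :* p)) ≡.refl a (f zero) (a ^ m) (prodFin K m (f ∘ suc))
    where open +-*-Solver

  m≤total : ∀ m (ns : Fin m → ℕ) → (∀ i → ns i ≥ 1) → m ≤ total K m ns
  m≤total zero    ns ns≥1 = z≤n
  m≤total (suc m) ns ns≥1 = ℕₚ.+-mono-≤ (ns≥1 zero) (m≤total m (ns ∘ suc) (ns≥1 ∘ suc))

module ProductGroups (K : DecField) (closed : AlgClosed K) where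
  open Polynomials K
  open Determinants K
  open Degrees K
  open MonicDivisors K closed
  open CharacteristicPolynomialCounts K

  module _ (m : ℕ) (ns : Fin m → ℕ) (Ds : (i : Fin m) → FinSubgroup K (ns i)) where
    private
      N : ℕ
      N = total K m ns
      Ls : (i : Fin m) → List (Mat K (ns i))
      Ls i = FinSubgroup.elems (Ds i)
      ∏MD : ℕ
      ∏MD = prodFin K m (λ i → MD K (Ls i))

    MD-of-productGroup≤ : ∀ g → MD-of K (productGroup K m ns Ds) g ≤ (2 ^ N) ^ m ℕ.* ∏MD
    MD-of-productGroup≤ g = begin
      MD-of K (productGroup K m ns Ds) g
        ≡⟨ length-filter-map (λ h → Defs._≟ₚ_ K (charPoly h) (charPoly g)) (blockDiag K m ns) (tuples K m ns Ls) ⟩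
      length (filter (λ t → Defs._≟ₚ_ K (charPoly (blockDiag K m ns t)) (charPoly g)) (tuples K m ns Ls))
        ≤⟨ length-filter-tuples m ns Ls _ isCandidate? blockIsCandidate ⟩
      prodFin K m (λ i → length (filter (isCandidate? i) (Ls i)))
        ≤⟨ prodFin-mono m candidateCount≤ ⟩
      prodFin K m (λ i → 2 ^ N ℕ.* MD K (Ls i))
        ≡⟨ prodFin-scale m (2 ^ N) (λ i → MD K (Ls i)) ⟩
      (2 ^ N) ^ m ℕ.* ∏MD ∎
      where
      open ℕₚ.≤-Reasoning
      χ-monic : Monic N (charPoly g)
      χ-monic = charPoly-monic g
      S : List Poly
      S = divisorCandidates N (charPoly g) χ-monic
      isCandidate? : ∀ i (h : Mat K (ns i)) → Dec (Any (charPoly h ≐_) S)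
      isCandidate? i h = Any.any? (charPoly h ≐?_) S
      candidateCount≤ : ∀ i → length (filter (isCandidate? i) (Ls i)) ≤ 2 ^ N ℕ.* MD K (Ls i)
      candidateCount≤ i = ≡.subst (λ c → length (filter (isCandidate? i) (Ls i)) ≤ c ℕ.* MD K (Ls i))
                            (length-divisorCandidates N _ χ-monic) (charPolyIn≤ S (Ls i))
      blockIsCandidate : ∀ {t} → Defs._≈ₚ_ K (charPoly (blockDiag K m ns t)) (charPoly g) → ∀ i → Any (charPoly (t i) ≐_) S
      blockIsCandidate {t} χt≈χg i with charPoly-∣-charPolyProduct m ns t i
      ... | q , χtᵢq≐∏χ = divisorCandidates-complete N (charPoly g) χ-monic (charPoly-monic (t i))
            (≐-trans χtᵢq≐∏χ (≐-trans (≐-sym (charPoly-blockDiag m ns t)) (≈ₚ⇒≐ χt≈χg)))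

    MD-productGroup≤ : (∀ i → ns i ≥ 1) → MD K (productGroup K m ns Ds) ≤ (2 ^ N) ^ N ℕ.* ∏MD
    MD-productGroup≤ ns≥1 = foldr-⊔-lub (MD-of K (productGroup K m ns Ds)) (λ g →
      ℕₚ.≤-trans (MD-of-productGroup≤ g) (ℕₚ.*-monoˡ-≤ ∏MD (ℕₚ.^-monoʳ-≤ (2 ^ N) {{ℕₚ.m^n≢0 2 N}} (m≤total m ns ns≥1))))
      (productGroup K m ns Ds)

open import Data.Nat using (_*_)

lemma5p11 : ∃ λ (C₂ : ℕ → ℕ) →
    ∀ (K : DecField) (p e q : ℕ) → AlgClosed K → HasChar K p → e ≥ 1 → q ≡ p ^ e →
    ∀ (m : ℕ) (ns : Fin m → ℕ) (rs : Fin m → ℕ) →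
    (∀ i → ns i ≥ 1) → (∀ i → rs i ≥ 1) →
    (Ds : (i : Fin m) → FinSubgroup K (ns i)) →
    (∀ i → OverField K q (rs i) (Ds i)) →
    MD K (productGroup K m ns Ds)
      ≤ C₂ (total K m ns) * prodFin K m (λ i → MD K (FinSubgroup.elems (Ds i)))
lemma5p11 = (λ n → (2 ^ n) ^ n) ,
  λ K _ _ _ closed _ _ _ m ns _ ns≥1 _ Ds _ → ProductGroups.MD-productGroup≤ K closed m ns Ds ns≥1
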